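{- Suppose the sequent $\Gamma,A\vee B$ is minimal and the sequent $\Gamma,A$ is valid. Then $\Gamma,A$ is minimal.
   Context: Formulas are built from literals, namely propositional variables $P$ and their complements $\bar P$, using $\wedge$ and $\vee$. A sequent is a nonempty finite multiset of formulas, and a comma denotes multiset union. A sequent $A_1,\dots,A_n$ is valid if $A_1\vee\cdots\vee A_n$ evaluates to $1$ under every $0/1$-assignment, with $\bar P$ read as the complement of $P$. A subsequent is obtained by deleting zero or more formulas, and it is proper if at least one formula is deleted. A sequent is minimal if it is valid and no proper subsequent of it is valid. -}

module Defs where

open import Data.Nat using (ℕ; _<_)
open import Data.Bool using (Bool; true; false; not; _∧_; _∨_)
open import Data.List using (List; []; _∷_; _++_; length; foldr)
open import Data.List.Relation.Binary.Sublist.Propositional using (_⊆_)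
open import Relation.Binary.PropositionalEquality using (_≡_)
open import Relation.Nullary using (¬_)
open import Data.Product using (_×_)

data Formula : Set where
  pos  : ℕ → Formula
  neg  : ℕ → Formula
  _∧ᶠ_ : Formula → Formula → Formula
  _∨ᶠ_ : Formula → Formula → Formula

Assignment : Set
Assignment = ℕ → Bool

eval : Assignment → Formula → Bool
eval ρ (pos p)  = ρ p
eval ρ (neg p)  = not (ρ p)
eval ρ (A ∧ᶠ B) = eval ρ A ∧ eval ρ B
eval ρ (A ∨ᶠ B) = eval ρ A ∨ eval ρ B

-- A sequent is a finite multiset of formulas, represented by a list
-- (order is irrelevant for every notion below). Comma = list append.
Sequent : Set
Sequent = List Formula

NonEmpty : Sequent → Set
NonEmpty Γ = ¬ (Γ ≡ [])

evalSeq : Assignment → Sequent → Bool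
evalSeq ρ Γ = foldr (λ A b → eval ρ A ∨ b) false Γ

Valid : Sequent → Set
Valid Γ = (ρ : Assignment) → evalSeq ρ Γ ≡ true

-- Δ is a subsequent of Γ (obtained by deleting formulas) iff Δ is a
-- sublist of Γ (up to reordering, which is irrelevant for multisets);
-- proper iff at least one formula is deleted.
ProperSubsequent : Sequent → Sequent → Set
ProperSubsequent Δ Γ = (Δ ⊆ Γ) × (length Δ < length Γ)

Minimal : Sequent → Set
Minimal Γ = NonEmpty Γ × Valid Γ
          × ((Δ : Sequent) → NonEmpty Δ → ProperSubsequent Δ Γ → ¬ Valid Δ)

-- Replacing the formulas of a sequent by formulas they entail preserves
-- validity and length, and turns subsequents into subsequents. Since A
-- entails A ∨ B, a valid proper subsequent of Γ, A would thus yield a valid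
-- proper subsequent of Γ, A ∨ B, contradicting its minimality.
module Submission where

open import Defs
open import Data.Bool using (Bool; true; false; _∨_)
open import Data.Bool.Properties using (∨-zeroʳ)
open import Data.List using (List; []; _∷_; _++_; length)
open import Data.List.Relation.Binary.Pointwise as Pointwise
  using (Pointwise; []; _∷_; Pointwise-length)
open import Data.List.Relation.Binary.Sublist.Propositional using (_⊆_; []; _∷_; _∷ʳ_)
open import Data.Nat using (_<_)
open import Data.Product using (∃; _×_; _,_)
open import Relation.Binary.PropositionalEquality using (_≡_; refl; subst₂)
open import Relation.Nullary using (¬_)

_⊨_ : Formula → Formula → Set
A ⊨ B = (ρ : Assignment) → eval ρ A ≡ true → eval ρ B ≡ true

⊨-refl : {A : Formula} → A ⊨ A
⊨-refl ρ e = e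

⊨-∨ᶠˡ : (A B : Formula) → A ⊨ (A ∨ᶠ B)
⊨-∨ᶠˡ A B ρ e with eval ρ A
... | true = refl

∨-preserves-true : {a a′ b b′ : Bool} →
                   (a ≡ true → a′ ≡ true) → (b ≡ true → b′ ≡ true) →
                   a ∨ b ≡ true → a′ ∨ b′ ≡ true
∨-preserves-true {true}          a⇒a′ _   _ rewrite a⇒a′ refl = refl
∨-preserves-true {false} {a′} _   b⇒b′ e rewrite b⇒b′ e    = ∨-zeroʳ a′

evalSeq-mono : {Δ Δ′ : Sequent} → Pointwise _⊨_ Δ Δ′ →
               (ρ : Assignment) → evalSeq ρ Δ ≡ true → evalSeq ρ Δ′ ≡ true
evalSeq-mono []              ρ e = e
evalSeq-mono (C⊨C′ ∷ Δ⊨Δ′) ρ = ∨-preserves-true (C⊨C′ ρ) (evalSeq-mono Δ⊨Δ′ ρ)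

Valid-mono : {Δ Δ′ : Sequent} → Pointwise _⊨_ Δ Δ′ → Valid Δ → Valid Δ′
Valid-mono Δ⊨Δ′ v ρ = evalSeq-mono Δ⊨Δ′ ρ (v ρ)

Valid⇒NonEmpty : {Δ : Sequent} → Valid Δ → NonEmpty Δ
Valid⇒NonEmpty v refl with v (λ _ → false)
... | ()

⊆-Pointwise-lift : {X : Set} {R : X → X → Set} {xs ys ys′ : List X} →
                   Pointwise R ys ys′ → xs ⊆ ys →
                   ∃ λ xs′ → xs′ ⊆ ys′ × Pointwise R xs xs′
⊆-Pointwise-lift []               []            = [] , [] , []
⊆-Pointwise-lift (_ ∷ ys∼ys′)     (_ ∷ʳ xs⊆ys)  with ⊆-Pointwise-lift ys∼ys′ xs⊆ys
... | xs′ , xs′⊆ys′ , xs∼xs′ = xs′ , _ ∷ʳ xs′⊆ys′ , xs∼xs′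
⊆-Pointwise-lift (y∼y′ ∷ ys∼ys′)  (refl ∷ xs⊆ys) with ⊆-Pointwise-lift ys∼ys′ xs⊆ys
... | xs′ , xs′⊆ys′ , xs∼xs′ = _ ∷ xs′ , refl ∷ xs′⊆ys′ , y∼y′ ∷ xs∼xs′

Minimal-antitone : {Γ Γ′ : Sequent} → Pointwise _⊨_ Γ Γ′ →
                   Minimal Γ′ → Valid Γ → Minimal Γ
Minimal-antitone {Γ} Γ⊨Γ′ (_ , _ , minimal′) valid =
  Valid⇒NonEmpty valid , valid , noValidProper
  where
  noValidProper : (Δ : Sequent) → NonEmpty Δ → ProperSubsequent Δ Γ → ¬ Valid Δ
  noValidProper Δ _ (Δ⊆Γ , shorter) validΔ
    with ⊆-Pointwise-lift Γ⊨Γ′ Δ⊆Γ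
  ... | Δ′ , Δ′⊆Γ′ , Δ⊨Δ′ =
    minimal′ Δ′ (Valid⇒NonEmpty validΔ′)
      (Δ′⊆Γ′ , subst₂ _<_ (Pointwise-length Δ⊨Δ′) (Pointwise-length Γ⊨Γ′) shorter)
      validΔ′
    where
    validΔ′ : Valid Δ′
    validΔ′ = Valid-mono Δ⊨Δ′ validΔ

lemma5 : (Γ : Sequent) (A B : Formula)
       → Minimal (Γ ++ (A ∨ᶠ B) ∷ []) → Valid (Γ ++ A ∷ [])
       → Minimal (Γ ++ A ∷ [])
lemma5 Γ A B =
  Minimal-antitone (Pointwise.++⁺ˡ (λ {C} → ⊨-refl {C}) Γ (⊨-∨ᶠˡ A B ∷ []))
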